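{- For integers $k\ge1$ and $N\ge k+2$, $$W_2(N,k)=\theta^2P_{N-2}\,W_2(N-1,k)+\theta\,T_2(N-1,k),$$ with initial condition $W_2(k+1,k)=\theta\,(P_k)!$.
   Context: Let $\theta>0$. $\mathrm{inv}(\pi)$ is the number of pairs $i<j$ with $\pi_i>\pi_j$. $P_n=1+\theta+\cdots+\theta^{n-1}$, $(P_n)!=P_n\cdots P_1$. For $\pi\in S_n$, position $i$ is a left-to-right second maximum if exactly one $j<i$ has $\pi_j>\pi_i$. The strategy $S^2_k$ rejects the first $k$ candidates and then accepts the first subsequent left-to-right second maximum (if any). $\pi\in S_n$ is $k$-pickable if $S^2_k$ selects some position, and $k$-winnable if $S^2_k$ selects a position holding value $n-1$. $T_2(n,k)=\sum_{\pi\in S_n\text{ not }k\text{ -pickable}}\theta^{\mathrm{inv}(\pi)}$ and $W_2(n,k)=\sum_{\pi\in S_n\ k\text{ -winnable}}\theta^{\mathrm{inv}(\pi)}$.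
   Formalization: The parameter θ ranges over the positive rationals instead of all positive reals. -}

module Defs where

open import Data.Nat as Nat using (ℕ; zero; suc; _∸_; _<ᵇ_; _≤ᵇ_; _≡ᵇ_)
open import Data.Bool using (Bool; true; false; _∧_; not; if_then_else_)
open import Data.List using (List; []; _∷_; _++_; [_]; length; filter; map; concatMap; foldr; upTo)
open import Data.Maybe using (Maybe; just; nothing)
open import Data.Rational using (ℚ; 0ℚ; 1ℚ; _+_; _*_)

-- Permutations of {1,…,n} are encoded as lists π = [π₁,…,πₙ] (one-line notation).

words : ℕ → ℕ → List (List ℕ)
words n zero    = [] ∷ []
words n (suc m) = concatMap (λ x → map (x ∷_) (words n m)) (map suc (upTo n))

elemᵇ : ℕ → List ℕ → Bool
elemᵇ x []       = false
elemᵇ x (y ∷ ys) = if x ≡ᵇ y then true else elemᵇ x ys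

distinctᵇ : List ℕ → Bool
distinctᵇ []       = true
distinctᵇ (x ∷ xs) = not (elemᵇ x xs) ∧ distinctᵇ xs

Sym : ℕ → List (List ℕ)
Sym n = filter (λ π → distinctᵇ π Data.Bool.≟ true) (words n n)

countGreater : ℕ → List ℕ → ℕ
countGreater v xs = length (filter (λ x → v Nat.<? x) xs)

inv : List ℕ → ℕ
inv []       = 0
inv (x ∷ xs) = length (filter (λ y → y Nat.<? x) xs) Nat.+ inv xs

-- Strategy S²_k.  scan k pos prefix rest: pos = number of positions already
-- seen (so the head of rest is at 1-based position pos+1), prefix = those
-- entries.  Position pos+1 is accepted iff pos+1 > k (i.e. k ≤ pos) and it is
-- a left-to-right second maximum (exactly one earlier entry is larger).
scan : ℕ → ℕ → List ℕ → List ℕ → Maybe ℕ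
scan k pos prefix []       = nothing
scan k pos prefix (x ∷ xs) =
  if (k ≤ᵇ pos) ∧ (countGreater x prefix ≡ᵇ 1)
  then just x
  else scan k (suc pos) (prefix ++ [ x ]) xs

select : ℕ → List ℕ → Maybe ℕ
select k π = scan k 0 [] π

isNothingᵇ : Maybe ℕ → Bool
isNothingᵇ nothing  = true
isNothingᵇ (just _) = false

isJustᵇ : ℕ → Maybe ℕ → Bool
isJustᵇ v nothing  = false
isJustᵇ v (just w) = v ≡ᵇ w

pickableᵇ : ℕ → List ℕ → Bool
pickableᵇ k π = not (isNothingᵇ (select k π))

winnableᵇ : ℕ → ℕ → List ℕ → Bool
winnableᵇ n k π = isJustᵇ (n ∸ 1) (select k π)

pow : ℚ → ℕ → ℚ
pow θ zero    = 1ℚ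
pow θ (suc m) = θ * pow θ m

sumℚ : List ℚ → ℚ
sumℚ = foldr _+_ 0ℚ

P : ℚ → ℕ → ℚ
P θ n = sumℚ (map (pow θ) (upTo n))

Pfact : ℚ → ℕ → ℚ
Pfact θ zero    = 1ℚ
Pfact θ (suc n) = P θ (suc n) * Pfact θ n

T₂ : ℚ → ℕ → ℕ → ℚ
T₂ θ n k = sumℚ (map (λ π → pow θ (inv π))
                     (filter (λ π → pickableᵇ k π Data.Bool.≟ false) (Sym n)))

W₂ : ℚ → ℕ → ℕ → ℚ
W₂ θ n k = sumℚ (map (λ π → pow θ (inv π))
                     (filter (λ π → winnableᵇ n k π Data.Bool.≟ true) (Sym n)))

{-# OPTIONS --safe #-}
-- Each π ∈ S_{n+1} is extend x σ for exactly one x ∈ {1,…,n+1} (its last entry) and σ ∈ S_n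
-- (its first n entries, relabelled order-preservingly onto {1,…,n}); then inv π = inv σ + (n+1−x).
-- S²_k only compares entries, so on the first n positions it runs on π as on σ, and it accepts
-- the last position iff k ≤ n and x = n. Hence, for N = m+2: if x ≤ m, π is won iff σ is, which
-- contributes θ^{m+2−x} W₂(m+1,k), in total θ² P_m W₂(m+1,k); if x = m+1, π is won iff σ is not
-- k-pickable, contributing θ T₂(m+1,k); if x = m+2, the value m+1 is the maximum of the prefix
-- and is never selected. For N = k+1 nothing is selected before the last position, so π is won
-- iff x = k, and the sum is θ ∑_{σ ∈ S_k} θ^{inv σ} = θ (P_k)!.
module Submission where

open import Defs

module _ where
  open import Data.Bool using (Bool; true; false; _∧_; _∨_; not; if_then_else_; T)
  open import Data.Bool.Properties
    using (T-≡; ∧-identityʳ; ∧-zeroʳ; ∧-assoc; ∨-zeroʳ; ∨-identityʳ; ∧-conicalˡ; ∧-conicalʳ;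
           ¬-not; not-injective)
  open import Data.List using (List; []; _∷_; _++_; _∷ʳ_; [_]; length; filter; map)
  open import Data.List.Properties using (map-++; length-map; ++-assoc; ++-identityʳ)
  open import Data.List.Relation.Unary.All as All using (All; []; _∷_)
  open import Data.List.Relation.Unary.All.Properties using (∷ʳ⁺)
  open import Data.Maybe as Maybe using (Maybe; just; nothing; _<∣>_)
  open import Data.Nat
  open import Data.Nat.Properties
  open import Data.Product using (_×_; _,_; proj₁; proj₂)
  open import Function using (_∘_)
  open import Function.Bundles using (Equivalence)
  open import Relation.Binary.PropositionalEquality hiding ([_])
  open import Relation.Nullary using (¬_; contradiction)
  open import Relation.Nullary.Decidable using (does; yes; no)
  open import Relation.Nullary.Reflects using (Reflects; ofʸ; ofⁿ; fromEquivalence)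
  open import Relation.Unary using (Pred; Decidable)

  ≡ᵇ-reflects-≡ : ∀ m n → Reflects (m ≡ n) (m ≡ᵇ n)
  ≡ᵇ-reflects-≡ m n = fromEquivalence (≡ᵇ⇒≡ m n) (≡⇒≡ᵇ m n)

  ≡ᵇ-refl : ∀ n → (n ≡ᵇ n) ≡ true
  ≡ᵇ-refl n = Equivalence.to T-≡ (≡⇒≡ᵇ n n refl)

  ≢⇒≡ᵇ-false : ∀ {m n} → m ≢ n → (m ≡ᵇ n) ≡ false
  ≢⇒≡ᵇ-false {m} {n} m≢n with m ≡ᵇ n | ≡ᵇ-reflects-≡ m n
  ... | false | _        = refl
  ... | true  | ofʸ m≡n = contradiction m≡n m≢n

  ≤⇒<ᵇ-false : ∀ {m n} → n ≤ m → (m <ᵇ n) ≡ false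
  ≤⇒<ᵇ-false {m} {n} n≤m with m <ᵇ n | <ᵇ-reflects-< m n
  ... | false | _        = refl
  ... | true  | ofʸ m<n = contradiction m<n (≤⇒≯ n≤m)

  ≤⇒≤ᵇ-true : ∀ {m n} → m ≤ n → (m ≤ᵇ n) ≡ true
  ≤⇒≤ᵇ-true m≤n = Equivalence.to T-≡ (≤⇒≤ᵇ m≤n)

  >⇒≤ᵇ-false : ∀ {m n} → n < m → (m ≤ᵇ n) ≡ false
  >⇒≤ᵇ-false {m} {n} n<m with m ≤ᵇ n | ≤ᵇ-reflects-≤ m n
  ... | false | _        = refl
  ... | true  | ofʸ m≤n = contradiction m≤n (<⇒≱ n<m)

  <ᵇ≡true⇒< : ∀ {m n} → (m <ᵇ n) ≡ true → m < n
  <ᵇ≡true⇒< {m} {n} m<ᵇn = <ᵇ⇒< m n (Equivalence.from T-≡ m<ᵇn)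

  <ᵇ≡false⇒≥ : ∀ {m n} → (m <ᵇ n) ≡ false → n ≤ m
  <ᵇ≡false⇒≥ m≮ᵇn = ≮⇒≥ λ m<n → subst T m≮ᵇn (<⇒<ᵇ m<n)

  lift : ℕ → ℕ → ℕ
  lift zero    z       = suc z
  lift (suc x) zero    = zero
  lift (suc x) (suc z) = suc (lift x z)

  lift-< : ∀ {x z} → z < x → lift x z ≡ z
  lift-< {suc x} {zero}  _         = refl
  lift-< {suc x} {suc z} (s≤s z<x) = cong suc (lift-< z<x)

  lift-≥ : ∀ {x z} → x ≤ z → lift x z ≡ suc z
  lift-≥ {zero}          _         = refl
  lift-≥ {suc x} {suc z} (s≤s x≤z) = cong suc (lift-≥ x≤z)

  lift-≢ : ∀ x z → lift x z ≢ x
  lift-≢ zero    z       ()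
  lift-≢ (suc x) zero    ()
  lift-≢ (suc x) (suc z) = lift-≢ x z ∘ suc-injective

  OrderEmbedding : (ℕ → ℕ) → Set
  OrderEmbedding g = ∀ a b → (g a <ᵇ g b) ≡ (a <ᵇ b)

  lift-orderEmbedding : ∀ x → OrderEmbedding (lift x)
  lift-orderEmbedding zero    a       b       = refl
  lift-orderEmbedding (suc x) zero    zero    = refl
  lift-orderEmbedding (suc x) zero    (suc b) = refl
  lift-orderEmbedding (suc x) (suc a) zero    = refl
  lift-orderEmbedding (suc x) (suc a) (suc b) = lift-orderEmbedding x a b

  <ᵇ-lift : ∀ x z → (x <ᵇ lift x z) ≡ not (z <ᵇ x)
  <ᵇ-lift zero    z       = refl
  <ᵇ-lift (suc x) zero    = refl
  <ᵇ-lift (suc x) (suc z) = <ᵇ-lift x z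

  count : (ℕ → Bool) → List ℕ → ℕ
  count p []       = 0
  count p (x ∷ xs) = if p x then suc (count p xs) else count p xs

  length-filter : ∀ {ℓ} {P : Pred ℕ ℓ} (P? : Decidable P) xs →
                  length (filter P? xs) ≡ count (does ∘ P?) xs
  length-filter P? []       = refl
  length-filter P? (x ∷ xs) with does (P? x)
  ... | true  = cong suc (length-filter P? xs)
  ... | false = length-filter P? xs

  countGreater≡count : ∀ v xs → countGreater v xs ≡ count (v <ᵇ_) xs
  countGreater≡count v = length-filter (v <?_)

  inv-∷ : ∀ x xs → inv (x ∷ xs) ≡ count (_<ᵇ x) xs + inv xs
  inv-∷ x xs = cong (_+ inv xs) (length-filter (_<? x) xs)

  count-cong : ∀ {p q} → (∀ z → p z ≡ q z) → ∀ xs → count p xs ≡ count q xs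
  count-cong p≗q []       = refl
  count-cong p≗q (x ∷ xs) rewrite p≗q x | count-cong p≗q xs = refl

  count-map : ∀ p (g : ℕ → ℕ) xs → count p (map g xs) ≡ count (p ∘ g) xs
  count-map p g []       = refl
  count-map p g (x ∷ xs) rewrite count-map p g xs = refl

  count-∷ʳ : ∀ p ys x → count p (ys ∷ʳ x) ≡ count p (x ∷ ys)
  count-∷ʳ p []       x = refl
  count-∷ʳ p (y ∷ ys) x rewrite count-∷ʳ p ys x with p x | p y
  ... | true  | true  = refl
  ... | true  | false = refl
  ... | false | _     = refl

  inv-∷ʳ : ∀ ys x → inv (ys ∷ʳ x) ≡ inv ys + count (x <ᵇ_) ys
  inv-∷ʳ []       x = refl
  inv-∷ʳ (y ∷ ys) x
    rewrite inv-∷ y (ys ∷ʳ x) | inv-∷ y ys | count-∷ʳ (_<ᵇ y) ys x | inv-∷ʳ ys x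
    with x <ᵇ y
  ... | true  = trans (cong suc (sym (+-assoc a i c))) (sym (+-suc (a + i) c))
    where
    a = count (_<ᵇ y) ys
    i = inv ys
    c = count (x <ᵇ_) ys
  ... | false = sym (+-assoc (count (_<ᵇ y) ys) (inv ys) (count (x <ᵇ_) ys))

  count-complement : ∀ p xs → count p xs + count (not ∘ p) xs ≡ length xs
  count-complement p []       = refl
  count-complement p (x ∷ xs) with p x
  ... | true  = cong suc (count-complement p xs)
  ... | false = trans (+-suc (count p xs) _) (cong suc (count-complement p xs))

  elemᵇ-∷ʳ : ∀ v ys x → elemᵇ v (ys ∷ʳ x) ≡ elemᵇ v ys ∨ (v ≡ᵇ x)
  elemᵇ-∷ʳ v []       x with v ≡ᵇ x
  ... | true  = refl
  ... | false = refl
  elemᵇ-∷ʳ v (y ∷ ys) x with v ≡ᵇ y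
  ... | true  = refl
  ... | false = elemᵇ-∷ʳ v ys x

  elemᵇ-here : ∀ x w → elemᵇ x (x ∷ w) ≡ true
  elemᵇ-here x w rewrite ≡ᵇ-refl x = refl

  elemᵇ-there : ∀ {x} y w → elemᵇ x w ≡ true → elemᵇ x (y ∷ w) ≡ true
  elemᵇ-there {x} y w x∈w with x ≡ᵇ y
  ... | true  = refl
  ... | false = x∈w

  distinctᵇ-∷ʳ : ∀ ys x → distinctᵇ (ys ∷ʳ x) ≡ distinctᵇ ys ∧ not (elemᵇ x ys)
  distinctᵇ-∷ʳ []       x = refl
  distinctᵇ-∷ʳ (y ∷ ys) x rewrite elemᵇ-∷ʳ y ys x | distinctᵇ-∷ʳ ys x
    with x ≡ᵇ y | ≡ᵇ-reflects-≡ x y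
  ... | true  | ofʸ refl
    rewrite ≡ᵇ-refl x | ∨-zeroʳ (elemᵇ x ys) = sym (∧-zeroʳ _)
  ... | false | ofⁿ x≢y
    rewrite ≢⇒≡ᵇ-false (≢-sym x≢y) | ∨-identityʳ (elemᵇ y ys)
    = sym (∧-assoc (not (elemᵇ y ys)) (distinctᵇ ys) _)

  module _ {g : ℕ → ℕ} (g-emb : OrderEmbedding g) where

    orderEmbedding-injective : ∀ {a b} → g a ≡ g b → a ≡ b
    orderEmbedding-injective {a} {b} ga≡gb = ≤-antisym (≮⇒≥ (≮ (sym ga≡gb))) (≮⇒≥ (≮ ga≡gb))
      where
      ≮ : ∀ {a b} → g a ≡ g b → ¬ a < b
      ≮ {a} {b} ga≡gb a<b =
        <-irrefl ga≡gb (<ᵇ⇒< (g a) (g b) (subst T (sym (g-emb a b)) (<⇒<ᵇ a<b)))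

    ≡ᵇ-orderEmbedding : ∀ a b → (g a ≡ᵇ g b) ≡ (a ≡ᵇ b)
    ≡ᵇ-orderEmbedding a b with a ≡ᵇ b | ≡ᵇ-reflects-≡ a b
    ... | true  | ofʸ refl = ≡ᵇ-refl (g a)
    ... | false | ofⁿ a≢b = ≢⇒≡ᵇ-false (a≢b ∘ orderEmbedding-injective)

    elemᵇ-map : ∀ a as → elemᵇ (g a) (map g as) ≡ elemᵇ a as
    elemᵇ-map a []       = refl
    elemᵇ-map a (b ∷ as) rewrite ≡ᵇ-orderEmbedding a b with a ≡ᵇ b
    ... | true  = refl
    ... | false = elemᵇ-map a as

    distinctᵇ-map : ∀ σ → distinctᵇ (map g σ) ≡ distinctᵇ σ
    distinctᵇ-map []      = refl
    distinctᵇ-map (a ∷ σ) rewrite elemᵇ-map a σ | distinctᵇ-map σ = refl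

    countGreater-map : ∀ v xs → countGreater (g v) (map g xs) ≡ countGreater v xs
    countGreater-map v xs = begin
      countGreater (g v) (map g xs) ≡⟨ countGreater≡count (g v) (map g xs) ⟩
      count (g v <ᵇ_) (map g xs)    ≡⟨ count-map (g v <ᵇ_) g xs ⟩
      count (λ z → g v <ᵇ g z) xs   ≡⟨ count-cong (g-emb v) xs ⟩
      count (v <ᵇ_) xs              ≡⟨ countGreater≡count v xs ⟨
      countGreater v xs             ∎
      where open ≡-Reasoning

    inv-map : ∀ σ → inv (map g σ) ≡ inv σ
    inv-map []      = refl
    inv-map (a ∷ σ) = begin
      inv (g a ∷ map g σ)                       ≡⟨ inv-∷ (g a) (map g σ) ⟩
      count (_<ᵇ g a) (map g σ) + inv (map g σ) ≡⟨ cong₂ _+_ count-lifted (inv-map σ) ⟩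
      count (_<ᵇ a) σ + inv σ                   ≡⟨ inv-∷ a σ ⟨
      inv (a ∷ σ)                               ∎
      where
      open ≡-Reasoning
      count-lifted : count (_<ᵇ g a) (map g σ) ≡ count (_<ᵇ a) σ
      count-lifted = trans (count-map (_<ᵇ g a) g σ) (count-cong (λ z → g-emb z a) σ)

    scan-map : ∀ k pos pre xs → scan k pos (map g pre) (map g xs) ≡ Maybe.map g (scan k pos pre xs)
    scan-map k pos pre []       = refl
    scan-map k pos pre (x ∷ xs) rewrite countGreater-map x pre
      with (k ≤ᵇ pos) ∧ (countGreater x pre ≡ᵇ 1)
    ... | true  = refl
    ... | false rewrite sym (map-++ g pre [ x ]) = scan-map k (suc pos) (pre ∷ʳ x) xs

  scan-∷ʳ : ∀ k pos pre ys x → scan k pos pre (ys ∷ʳ x) ≡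
    scan k pos pre ys <∣>
    (if (k ≤ᵇ pos + length ys) ∧ (countGreater x (pre ++ ys) ≡ᵇ 1) then just x else nothing)
  scan-∷ʳ k pos pre []       x rewrite +-identityʳ pos | ++-identityʳ pre = refl
  scan-∷ʳ k pos pre (y ∷ ys) x with (k ≤ᵇ pos) ∧ (countGreater y pre ≡ᵇ 1)
  ... | true  = refl
  ... | false rewrite scan-∷ʳ k (suc pos) (pre ∷ʳ y) ys x | ++-assoc pre [ y ] ys
                    | +-suc pos (length ys) = refl

  scan-short : ∀ k pos pre xs → pos + length xs ≤ k → scan k pos pre xs ≡ nothing
  scan-short k pos pre []       _ = refl
  scan-short k pos pre (x ∷ xs) short
    rewrite >⇒≤ᵇ-false {k} {pos} (<-≤-trans (m<m+n pos z<s) short)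
    = scan-short k (suc pos) (pre ∷ʳ x) xs (≤-trans (≤-reflexive (sym (+-suc pos (length xs)))) short)

  count-≡0 : ∀ {p} xs → All (λ z → p z ≡ false) xs → count p xs ≡ 0
  count-≡0 []       []               = refl
  count-≡0 (x ∷ xs) (px≡false ∷ rest) rewrite px≡false = count-≡0 xs rest

  secondMax-< : ∀ {n v} pre → All (_≤ n) pre → countGreater v pre ≡ 1 → v < n
  secondMax-< {n} {v} pre pre≤n one-greater with v <? n
  ... | yes v<n = v<n
  ... | no  v≮n = contradiction (trans (sym one-greater) none-greater) λ ()
    where
    none-greater : countGreater v pre ≡ 0
    none-greater = trans (countGreater≡count v pre)
      (count-≡0 pre (All.map (λ z≤bound → ≤⇒<ᵇ-false (≤-trans z≤bound (≮⇒≥ v≮n))) pre≤n))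

  scan-< : ∀ {n} k pos pre xs {v} → All (_≤ n) pre → All (_≤ n) xs → scan k pos pre xs ≡ just v → v < n
  scan-< k pos pre (x ∷ xs) pre≤n (x≤n ∷ xs≤n) found
    with (k ≤ᵇ pos) ∧ (countGreater x pre ≡ᵇ 1) in accept
  ... | true  with found
  ...   | refl = secondMax-< pre pre≤n
                   (≡ᵇ⇒≡ _ 1 (Equivalence.from T-≡ (∧-conicalʳ (k ≤ᵇ pos) _ accept)))
  scan-< k pos pre (x ∷ xs) pre≤n (x≤n ∷ xs≤n) found | false =
    scan-< k (suc pos) (pre ∷ʳ x) xs (∷ʳ⁺ pre≤n x≤n) xs≤n found

  count-split : ∀ (p q : ℕ → Bool) xs →
    count p xs ≡ count (λ z → p z ∧ q z) xs + count (λ z → p z ∧ not (q z)) xs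
  count-split p q []       = refl
  count-split p q (x ∷ xs) with p x | q x
  ... | true  | true  = cong suc (count-split p q xs)
  ... | true  | false = trans (cong suc (count-split p q xs)) (sym (+-suc _ _))
  ... | false | _     = count-split p q xs

  elemᵇ-false⇒≢ : ∀ {v} xs → elemᵇ v xs ≡ false → All (_≢ v) xs
  elemᵇ-false⇒≢ []                 _ = []
  elemᵇ-false⇒≢ {v} (y ∷ ys) v∉ with v ≡ᵇ y | ≡ᵇ-reflects-≡ v y
  ... | false | ofⁿ v≢y = ≢-sym v≢y ∷ elemᵇ-false⇒≢ ys v∉

  count-≤1 : ∀ {p h} xs → distinctᵇ xs ≡ true → All (λ z → p z ≡ true → z ≡ h) xs → count p xs ≤ 1
  count-≤1 []       _    _                   = z≤n
  count-≤1 {p} {h} (x ∷ xs) dist (px⇒x≡h ∷ pxs⇒≡h) with p x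
  ... | false = count-≤1 xs (∧-conicalʳ _ _ dist) pxs⇒≡h
  ... | true  = s≤s (≤-reflexive (count-≡0 xs (All.zipWith rest-false (pxs⇒≡h , others≢x))))
    where
    others≢x : All (_≢ x) xs
    others≢x = elemᵇ-false⇒≢ xs (not-injective (∧-conicalˡ _ _ dist))
    rest-false : ∀ {z} → (p z ≡ true → z ≡ h) × z ≢ x → p z ≡ false
    rest-false (pz⇒z≡h , z≢x) = ¬-not λ pz → z≢x (trans (pz⇒z≡h pz) (sym (px⇒x≡h refl)))

  count-≤-width : ∀ {p} lo w xs → distinctᵇ xs ≡ true →
    All (λ z → p z ≡ true → lo ≤ z × z < lo + w) xs → count p xs ≤ w
  count-≤-width {p} lo zero xs _ inside =
    ≤-reflexive (count-≡0 xs (All.map (λ inside-z → ¬-not (empty ∘ inside-z)) inside))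
    where
    empty : ∀ {z} → ¬ (lo ≤ z × z < lo + 0)
    empty (lo≤z , z<lo+0) = <⇒≱ z<lo+0 (subst (_≤ _) (sym (+-identityʳ lo)) lo≤z)
  count-≤-width {p} lo (suc w) xs dist inside = begin
    count p xs
      ≡⟨ count-split p (_<ᵇ lo + w) xs ⟩
    count p₁ xs + count p₂ xs
      ≤⟨ +-mono-≤ (count-≤-width lo w xs dist (All.map lower inside))
                  (count-≤1 xs dist (All.map top inside)) ⟩
    w + 1
      ≡⟨ +-comm w 1 ⟩
    suc w
      ∎
    where
    open ≤-Reasoning
    p₁ p₂ : ℕ → Bool
    p₁ z = p z ∧ (z <ᵇ lo + w)
    p₂ z = p z ∧ not (z <ᵇ lo + w)
    lower : ∀ {z} → (p z ≡ true → lo ≤ z × z < lo + suc w) → p₁ z ≡ true → lo ≤ z × z < lo + w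
    lower {z} inside-z p₁z =
      proj₁ (inside-z (∧-conicalˡ _ _ p₁z)) ,
      <ᵇ≡true⇒< (∧-conicalʳ (p z) _ p₁z)
    top : ∀ {z} → (p z ≡ true → lo ≤ z × z < lo + suc w) → p₂ z ≡ true → z ≡ lo + w
    top {z} inside-z p₂z = ≤-antisym
      (≤-pred (subst (z <_) (+-suc lo w) (proj₂ (inside-z (∧-conicalˡ _ _ p₂z)))))
      (<ᵇ≡false⇒≥ (not-injective (∧-conicalʳ (p z) _ p₂z)))

  record IsPerm (n : ℕ) (σ : List ℕ) : Set where
    field
      length≡  : length σ ≡ n
      bounded  : All (λ z → 1 ≤ z × z ≤ n) σ
      distinct : distinctᵇ σ ≡ true

  count-≥ : ∀ {n σ x} → IsPerm n σ → 1 ≤ x → x ≤ suc n → count (λ z → not (z <ᵇ x)) σ ≡ suc n ∸ x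
  count-≥ {n} {σ} {suc x} σ-perm 1≤x x≤1+n = ≤-antisym B≤ ≤B
    where
    open IsPerm σ-perm
    open ≤-Reasoning
    A = count (_<ᵇ suc x) σ
    B = count (λ z → not (z <ᵇ suc x)) σ
    A≤ : A ≤ x
    A≤ = count-≤-width 1 x σ distinct (All.map below bounded)
      where
      below : ∀ {z} → 1 ≤ z × z ≤ n → (z <ᵇ suc x) ≡ true → 1 ≤ z × z < 1 + x
      below (1≤z , _) z<ᵇx = 1≤z , <ᵇ≡true⇒< z<ᵇx
    B≤ : B ≤ suc n ∸ suc x
    B≤ = count-≤-width (suc x) (suc n ∸ suc x) σ distinct (All.map above bounded)
      where
      above : ∀ {z} → 1 ≤ z × z ≤ n → not (z <ᵇ suc x) ≡ true → suc x ≤ z × z < suc x + (suc n ∸ suc x)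
      above {z} (_ , z≤bound) z≮ᵇx =
        <ᵇ≡false⇒≥ (not-injective z≮ᵇx) , subst (z <_) (sym (m+[n∸m]≡n x≤1+n)) (s≤s z≤bound)
    A+B≡n : A + B ≡ n
    A+B≡n = trans (count-complement (_<ᵇ suc x) σ) length≡
    ≤B : n ∸ x ≤ B
    ≤B = begin
      n ∸ x      ≤⟨ ∸-monoʳ-≤ n A≤ ⟩
      n ∸ A      ≡⟨ cong (_∸ A) (sym A+B≡n) ⟩
      A + B ∸ A  ≡⟨ m+n∸m≡n A B ⟩
      B          ∎

  extend : ℕ → List ℕ → List ℕ
  extend x σ = map (lift x) σ ∷ʳ x

  countGreater-extend : ∀ {n σ x} → IsPerm n σ → 1 ≤ x → x ≤ suc n →
    countGreater x (map (lift x) σ) ≡ suc n ∸ x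
  countGreater-extend {n} {σ} {x} σ-perm 1≤x x≤1+n = begin
    countGreater x (map (lift x) σ) ≡⟨ countGreater≡count x (map (lift x) σ) ⟩
    count (x <ᵇ_) (map (lift x) σ)  ≡⟨ count-map (x <ᵇ_) (lift x) σ ⟩
    count (λ z → x <ᵇ lift x z) σ   ≡⟨ count-cong (<ᵇ-lift x) σ ⟩
    count (λ z → not (z <ᵇ x)) σ    ≡⟨ count-≥ σ-perm 1≤x x≤1+n ⟩
    suc n ∸ x                       ∎
    where
    open ≡-Reasoning

  inv-extend : ∀ {n σ x} → IsPerm n σ → 1 ≤ x → x ≤ suc n → inv (extend x σ) ≡ inv σ + (suc n ∸ x)
  inv-extend {n} {σ} {x} σ-perm 1≤x x≤1+n = begin
    inv (map (lift x) σ ∷ʳ x)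
      ≡⟨ inv-∷ʳ (map (lift x) σ) x ⟩
    inv (map (lift x) σ) + count (x <ᵇ_) (map (lift x) σ)
      ≡⟨ cong₂ _+_ (inv-map (lift-orderEmbedding x) σ) counted ⟩
    inv σ + (suc n ∸ x)
      ∎
    where
    open ≡-Reasoning
    counted : count (x <ᵇ_) (map (lift x) σ) ≡ suc n ∸ x
    counted = trans (sym (countGreater≡count x (map (lift x) σ))) (countGreater-extend σ-perm 1≤x x≤1+n)

  elemᵇ-lift : ∀ x σ → elemᵇ x (map (lift x) σ) ≡ false
  elemᵇ-lift x []      = refl
  elemᵇ-lift x (a ∷ σ) rewrite ≢⇒≡ᵇ-false (≢-sym (lift-≢ x a)) = elemᵇ-lift x σ

  distinctᵇ-extend : ∀ x σ → distinctᵇ (extend x σ) ≡ distinctᵇ σ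
  distinctᵇ-extend x σ = begin
    distinctᵇ (map (lift x) σ ∷ʳ x)
      ≡⟨ distinctᵇ-∷ʳ (map (lift x) σ) x ⟩
    distinctᵇ (map (lift x) σ) ∧ not (elemᵇ x (map (lift x) σ))
      ≡⟨ cong₂ (λ d e → d ∧ not e) (distinctᵇ-map (lift-orderEmbedding x) σ) (elemᵇ-lift x σ) ⟩
    distinctᵇ σ ∧ true
      ≡⟨ ∧-identityʳ _ ⟩
    distinctᵇ σ
      ∎
    where open ≡-Reasoning

  distinctᵇ-∷ʳ-elem : ∀ w x → elemᵇ x w ≡ true → distinctᵇ (w ∷ʳ x) ≡ false
  distinctᵇ-∷ʳ-elem w x x∈w rewrite distinctᵇ-∷ʳ w x | x∈w = ∧-zeroʳ _

  select-extend : ∀ {n σ x} k → IsPerm n σ → 1 ≤ x → x ≤ suc n →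
    select k (extend x σ) ≡
    Maybe.map (lift x) (select k σ) <∣> (if (k ≤ᵇ n) ∧ (suc n ∸ x ≡ᵇ 1) then just x else nothing)
  select-extend {n} {σ} {x} k σ-perm 1≤x x≤1+n =
    trans (scan-∷ʳ k 0 [] (map (lift x) σ) x)
          (cong₂ _<∣>_ (scan-map (lift-orderEmbedding x) k 0 [] σ)
                       (cong₂ (λ l c → if (k ≤ᵇ l) ∧ (c ≡ᵇ 1) then just x else nothing)
                              (trans (length-map (lift x) σ) (IsPerm.length≡ σ-perm))
                              (countGreater-extend σ-perm 1≤x x≤1+n)))

  isJustᵇ-if : ∀ {N x} c → N ≢ x → isJustᵇ N (if c then just x else nothing) ≡ false
  isJustᵇ-if true  N≢x = ≢⇒≡ᵇ-false N≢x
  isJustᵇ-if false _   = refl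

  winnable-extend-small : ∀ {m σ x} k → IsPerm (suc m) σ → 1 ≤ x → x ≤ m →
    winnableᵇ (suc (suc m)) k (extend x σ) ≡ winnableᵇ (suc m) k σ
  winnable-extend-small {m} {σ} {x} k σ-perm 1≤x x≤m
    rewrite select-extend k σ-perm 1≤x (m≤n⇒m≤1+n (m≤n⇒m≤1+n x≤m)) with select k σ
  ... | just v  = trans (cong (_≡ᵇ lift x v) (sym (lift-≥ x≤m)))
                        (≡ᵇ-orderEmbedding {lift x} (lift-orderEmbedding x) m v)
  ... | nothing = isJustᵇ-if ((k ≤ᵇ suc m) ∧ (suc (suc m) ∸ x ≡ᵇ 1))
                              λ 1+m≡x → 1+n≰n (subst (_≤ m) (sym 1+m≡x) x≤m)

  winnable-extend-secondLargest : ∀ {m σ} k → k ≤ m → IsPerm (suc m) σ →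
    winnableᵇ (suc (suc m)) k (extend (suc m) σ) ≡ not (pickableᵇ k σ)
  winnable-extend-secondLargest {m} {σ} k k≤m σ-perm
    rewrite select-extend k σ-perm (s≤s z≤n) (n≤1+n (suc m)) with select k σ
  ... | just v  = ≢⇒≡ᵇ-false (≢-sym (lift-≢ (suc m) v))
  ... | nothing rewrite m+n∸n≡m 1 m | ≤⇒≤ᵇ-true (m≤n⇒m≤1+n k≤m) = ≡ᵇ-refl m

  winnable-extend-largest : ∀ {m σ} k → IsPerm (suc m) σ →
    winnableᵇ (suc (suc m)) k (extend (suc (suc m)) σ) ≡ false
  winnable-extend-largest {m} {σ} k σ-perm
    rewrite select-extend k σ-perm (s≤s z≤n) ≤-refl with select k σ in selected
  ... | just v  = trans (cong (suc m ≡ᵇ_) (lift-< (m<n⇒m<1+n v<1+m))) (≢⇒≡ᵇ-false (>⇒≢ v<1+m))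
    where
    v<1+m : v < suc m
    v<1+m = scan-< k 0 [] σ [] (All.map proj₂ (IsPerm.bounded σ-perm)) selected
  ... | nothing = isJustᵇ-if ((k ≤ᵇ suc m) ∧ (suc m ∸ suc m ≡ᵇ 1)) (λ ())

  winnable-extend-initial : ∀ {k σ x} → IsPerm k σ → 1 ≤ x → x ≤ suc k →
    winnableᵇ (suc k) k (extend x σ) ≡ (k ≡ᵇ x)
  winnable-extend-initial {k} {σ} {x} σ-perm 1≤x x≤1+k
    rewrite select-extend k σ-perm 1≤x x≤1+k
          | scan-short k 0 [] σ (≤-reflexive (IsPerm.length≡ σ-perm))
    with k ≡ᵇ x | ≡ᵇ-reflects-≡ k x
  ... | true  | ofʸ refl rewrite ≤⇒≤ᵇ-true (≤-refl {k}) | m+n∸n≡m 1 k = ≡ᵇ-refl k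
  ... | false | ofⁿ k≢x = isJustᵇ-if ((k ≤ᵇ k) ∧ (suc k ∸ x ≡ᵇ 1)) k≢x

module _ where
  open import Algebra.Bundles using (CommutativeMonoid)
  open import Data.Bool using (Bool; true; false; not)
  import Data.Bool as Bool
  open import Data.List
    using (List; []; _∷_; _++_; _∷ʳ_; [_]; length; map; concatMap; filter; upTo; applyUpTo)
  open import Data.List.Properties using (map-++; upTo-∷ʳ)
  open import Data.List.Relation.Unary.All as All using (All; []; _∷_)
  open import Data.List.Relation.Unary.All.Properties
    using (map⁺; concat⁺; applyUpTo⁺₁; all-filter; filter⁺)
  open import Data.Nat as ℕ using (ℕ; zero; suc; _∸_; _≤_; _<_; _≡ᵇ_; z≤n; s≤s)
  import Data.Nat.Properties as ℕ
  open import Data.Product using (_×_; _,_)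
  open import Data.Rational using (ℚ; 0ℚ; 1ℚ; _+_; _*_)
  open import Data.Rational.Properties
  open import Data.Rational.Solver using (module +-*-Solver)
  open import Data.Sum using (inj₁; inj₂)
  open import Function using (_∘_; id)
  open import Relation.Binary.PropositionalEquality hiding ([_])
  open import Relation.Nullary.Decidable using (does)
  open import Relation.Unary using (Pred; Decidable)
  open import Algebra.Properties.CommutativeSemigroup
    (CommutativeMonoid.commutativeSemigroup +-0-commutativeMonoid)
    using () renaming (interchange to +-interchange)
  open import Algebra.Properties.CommutativeSemigroup
    (CommutativeMonoid.commutativeSemigroup *-1-commutativeMonoid)
    using () renaming (x∙yz≈y∙xz to *-leftComm)
  open ≡-Reasoning

  ∑ : {A : Set} → List A → (A → ℚ) → ℚ
  ∑ xs f = sumℚ (map f xs)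

  syntax ∑ xs (λ x → e) = ∑[ x ∈ xs ] e

  ⟦_⟧ : Bool → ℚ
  ⟦ true  ⟧ = 1ℚ
  ⟦ false ⟧ = 0ℚ

  variable
    A B : Set


  ∑-cong : ∀ (xs : List A) {f g} → (∀ x → f x ≡ g x) → ∑ xs f ≡ ∑ xs g
  ∑-cong []       _   = refl
  ∑-cong (x ∷ xs) f≗g = cong₂ _+_ (f≗g x) (∑-cong xs f≗g)

  ∑-cong-All : ∀ {xs : List A} {f g} → All (λ x → f x ≡ g x) xs → ∑ xs f ≡ ∑ xs g
  ∑-cong-All []       = refl
  ∑-cong-All (e ∷ es) = cong₂ _+_ e (∑-cong-All es)

  ∑-++ : ∀ (xs ys : List A) f → ∑ (xs ++ ys) f ≡ ∑ xs f + ∑ ys f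
  ∑-++ []       ys f = sym (+-identityˡ _)
  ∑-++ (x ∷ xs) ys f = trans (cong (f x +_) (∑-++ xs ys f)) (sym (+-assoc (f x) _ _))

  ∑-map : ∀ (xs : List A) (g : A → B) f → ∑ (map g xs) f ≡ ∑ xs (f ∘ g)
  ∑-map []       g f = refl
  ∑-map (x ∷ xs) g f = cong (f (g x) +_) (∑-map xs g f)

  ∑-concatMap : ∀ (xs : List A) (h : A → List B) f →
    ∑ (concatMap h xs) f ≡ ∑[ x ∈ xs ] ∑ (h x) f
  ∑-concatMap []       h f = refl
  ∑-concatMap (x ∷ xs) h f =
    trans (∑-++ (h x) (concatMap h xs) f) (cong (∑ (h x) f +_) (∑-concatMap xs h f))

  ∑-zero : ∀ (xs : List A) → ∑[ x ∈ xs ] 0ℚ ≡ 0ℚ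
  ∑-zero []       = refl
  ∑-zero (x ∷ xs) = trans (+-identityˡ _) (∑-zero xs)

  ∑-+ : ∀ (xs : List A) f g → ∑[ x ∈ xs ] (f x + g x) ≡ ∑ xs f + ∑ xs g
  ∑-+ []       f g = sym (+-identityˡ 0ℚ)
  ∑-+ (x ∷ xs) f g = trans (cong (f x + g x +_) (∑-+ xs f g)) (+-interchange (f x) (g x) _ _)

  ∑-*ˡ : ∀ (xs : List A) c f → ∑[ x ∈ xs ] (c * f x) ≡ c * ∑ xs f
  ∑-*ˡ []       c f = sym (*-zeroʳ c)
  ∑-*ˡ (x ∷ xs) c f = trans (cong (c * f x +_) (∑-*ˡ xs c f)) (sym (*-distribˡ-+ c (f x) _))

  ∑-*ʳ : ∀ (xs : List A) f c → ∑[ x ∈ xs ] (f x * c) ≡ ∑ xs f * c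
  ∑-*ʳ xs f c = trans (∑-cong xs (λ x → *-comm (f x) c)) (trans (∑-*ˡ xs c f) (*-comm c _))

  ∑-comm : ∀ (xs : List A) (ys : List B) (f : A → B → ℚ) →
    ∑[ x ∈ xs ] ∑[ y ∈ ys ] f x y ≡ ∑[ y ∈ ys ] ∑[ x ∈ xs ] f x y
  ∑-comm []       ys f = sym (∑-zero ys)
  ∑-comm (x ∷ xs) ys f =
    trans (cong (∑[ y ∈ ys ] f x y +_) (∑-comm xs ys f)) (sym (∑-+ ys (f x) (λ y → ∑[ x ∈ xs ] f x y)))

  ∑-filter : ∀ {ℓ} {P : Pred A ℓ} (P? : Decidable P) xs f →
    ∑ (filter P? xs) f ≡ ∑[ x ∈ xs ] (⟦ does (P? x) ⟧ * f x)
  ∑-filter P? []       f = refl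
  ∑-filter P? (x ∷ xs) f with does (P? x)
  ... | true  = cong₂ _+_ (sym (*-identityˡ (f x))) (∑-filter P? xs f)
  ... | false = trans (∑-filter P? xs f) (sym (trans (cong (_+ _) (*-zeroˡ (f x))) (+-identityˡ _)))

  range : ℕ → List ℕ
  range n = map suc (upTo n)

  range-bounds : ∀ n → All (λ x → 1 ≤ x × x ≤ n) (range n)
  range-bounds n = map⁺ (applyUpTo⁺₁ id n (λ i<n → s≤s z≤n , i<n))

  ∑-range-suc : ∀ n (f : ℕ → ℚ) → ∑ (range (suc n)) f ≡ ∑ (range n) f + f (suc n)
  ∑-range-suc n f = begin
    ∑ (map suc (upTo (suc n))) f        ≡⟨ cong (λ l → ∑ (map suc l) f) (upTo-∷ʳ n) ⟨
    ∑ (map suc (upTo n ∷ʳ n)) f         ≡⟨ cong (λ l → ∑ l f) (map-++ suc (upTo n) [ n ]) ⟩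
    ∑ (range n ++ [ suc n ]) f          ≡⟨ ∑-++ (range n) [ suc n ] f ⟩
    ∑ (range n) f + (f (suc n) + 0ℚ)    ≡⟨ cong (∑ (range n) f +_) (+-identityʳ (f (suc n))) ⟩
    ∑ (range n) f + f (suc n)           ∎

  ∑-range-lift : ∀ n {x} (f : ℕ → ℚ) → 1 ≤ x → x ≤ suc n → f x ≡ 0ℚ →
    ∑ (range (suc n)) f ≡ ∑[ y ∈ range n ] f (lift x y)
  ∑-range-lift n {x} f 1≤x x≤1+n fx≡0 with ℕ.m≤n⇒m<n∨m≡n x≤1+n
  ... | inj₂ refl = begin
    ∑ (range (suc n)) f                ≡⟨ ∑-range-suc n f ⟩
    ∑ (range n) f + f (suc n)          ≡⟨ cong (∑ (range n) f +_) fx≡0 ⟩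
    ∑ (range n) f + 0ℚ                 ≡⟨ +-identityʳ _ ⟩
    ∑ (range n) f                      ≡⟨ ∑-cong-All (All.map unlifted (range-bounds n)) ⟩
    ∑[ y ∈ range n ] f (lift (suc n) y) ∎
    where
    unlifted : ∀ {y} → 1 ≤ y × y ≤ n → f y ≡ f (lift (suc n) y)
    unlifted (_ , y≤n) = cong f (sym (lift-< (s≤s y≤n)))
  ∑-range-lift zero    f (s≤s _) _ _ | inj₁ (s≤s ())
  ∑-range-lift (suc n) {x} f 1≤x _ fx≡0 | inj₁ (s≤s x≤1+n) = begin
    ∑ (range (suc (suc n))) f
      ≡⟨ ∑-range-suc (suc n) f ⟩
    ∑ (range (suc n)) f + f (suc (suc n))
      ≡⟨ cong₂ _+_ (∑-range-lift n f 1≤x x≤1+n fx≡0) (cong f (sym (lift-≥ x≤1+n))) ⟩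
    ∑[ y ∈ range n ] f (lift x y) + f (lift x (suc n))
      ≡⟨ ∑-range-suc n (f ∘ lift x) ⟨
    ∑[ y ∈ range (suc n) ] f (lift x y)
      ∎

  ∑-range-⟦≡ᵇ⟧ : ∀ n {k} (f : ℕ → ℚ) → 1 ≤ k → k ≤ n → ∑[ x ∈ range n ] (⟦ k ≡ᵇ x ⟧ * f x) ≡ f k
  ∑-range-⟦≡ᵇ⟧ zero    f (s≤s _) ()
  ∑-range-⟦≡ᵇ⟧ (suc n) {k} f 1≤k k≤1+n with ℕ.m≤n⇒m<n∨m≡n k≤1+n
  ... | inj₂ refl = begin
    ∑[ x ∈ range (suc n) ] (⟦ suc n ≡ᵇ x ⟧ * f x)
      ≡⟨ ∑-range-suc n _ ⟩
    ∑[ x ∈ range n ] (⟦ suc n ≡ᵇ x ⟧ * f x) + ⟦ n ≡ᵇ n ⟧ * f (suc n)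
      ≡⟨ cong₂ _+_ others (cong (λ b → ⟦ b ⟧ * f (suc n)) (≡ᵇ-refl n)) ⟩
    0ℚ + 1ℚ * f (suc n)
      ≡⟨ trans (+-identityˡ _) (*-identityˡ _) ⟩
    f (suc n)
      ∎
    where
    vanish : ∀ {x} → 1 ≤ x × x ≤ n → ⟦ suc n ≡ᵇ x ⟧ * f x ≡ 0ℚ
    vanish {x} (_ , x≤n) =
      trans (cong (λ b → ⟦ b ⟧ * f x) (≢⇒≡ᵇ-false (ℕ.>⇒≢ (s≤s x≤n)))) (*-zeroˡ (f x))
    others : ∑[ x ∈ range n ] (⟦ suc n ≡ᵇ x ⟧ * f x) ≡ 0ℚ
    others = trans (∑-cong-All (All.map vanish (range-bounds n))) (∑-zero (range n))
  ... | inj₁ (s≤s k≤n) = begin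
    ∑[ x ∈ range (suc n) ] (⟦ k ≡ᵇ x ⟧ * f x)
      ≡⟨ ∑-range-suc n _ ⟩
    ∑[ x ∈ range n ] (⟦ k ≡ᵇ x ⟧ * f x) + ⟦ k ≡ᵇ suc n ⟧ * f (suc n)
      ≡⟨ cong₂ _+_ (∑-range-⟦≡ᵇ⟧ n f 1≤k k≤n) last ⟩
    f k + 0ℚ
      ≡⟨ +-identityʳ (f k) ⟩
    f k
      ∎
    where
    last : ⟦ k ≡ᵇ suc n ⟧ * f (suc n) ≡ 0ℚ
    last = trans (cong (λ b → ⟦ b ⟧ * f (suc n)) (≢⇒≡ᵇ-false (ℕ.<⇒≢ (s≤s k≤n)))) (*-zeroˡ (f (suc n)))

  ∑-applyUpTo : ∀ n (g : ℕ → ℕ) (f : ℕ → ℚ) → ∑ (applyUpTo g n) f ≡ ∑ (upTo n) (f ∘ g)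
  ∑-applyUpTo zero    g f = refl
  ∑-applyUpTo (suc n) g f =
    cong (f (g 0) +_) (trans (∑-applyUpTo n (g ∘ suc) f) (sym (∑-applyUpTo n suc (f ∘ g))))

  P-suc : ∀ θ n → P θ (suc n) ≡ 1ℚ + θ * P θ n
  P-suc θ n = cong (1ℚ +_) (trans (∑-applyUpTo n suc (pow θ)) (∑-*ˡ (upTo n) θ (pow θ)))

  ∑-words-∷ : ∀ n m (f : List ℕ → ℚ) →
    ∑ (words n (suc m)) f ≡ ∑[ x ∈ range n ] ∑[ w ∈ words n m ] f (x ∷ w)
  ∑-words-∷ n m f = trans (∑-concatMap (range n) (λ x → map (x ∷_) (words n m)) f)
                          (∑-cong (range n) (λ x → ∑-map (words n m) (x ∷_) f))

  ∑-words-∷ʳ : ∀ n m (f : List ℕ → ℚ) →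
    ∑ (words n (suc m)) f ≡ ∑[ w ∈ words n m ] ∑[ x ∈ range n ] f (w ∷ʳ x)
  ∑-words-∷ʳ n zero    f = begin
    ∑ (words n 1) f
      ≡⟨ ∑-words-∷ n zero f ⟩
    ∑[ x ∈ range n ] (f [ x ] + 0ℚ)
      ≡⟨ ∑-cong (range n) (λ x → +-identityʳ (f [ x ])) ⟩
    ∑[ x ∈ range n ] f [ x ]
      ≡⟨ +-identityʳ _ ⟨
    ∑[ x ∈ range n ] f [ x ] + 0ℚ
      ∎
  ∑-words-∷ʳ n (suc m) f = begin
    ∑ (words n (suc (suc m))) f
      ≡⟨ ∑-words-∷ n (suc m) f ⟩
    ∑[ x ∈ range n ] ∑[ w ∈ words n (suc m) ] f (x ∷ w)
      ≡⟨ ∑-cong (range n) (λ x → ∑-words-∷ʳ n m (f ∘ (x ∷_))) ⟩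
    ∑[ x ∈ range n ] ∑[ w ∈ words n m ] ∑[ y ∈ range n ] f (x ∷ w ∷ʳ y)
      ≡⟨ ∑-words-∷ n m _ ⟨
    ∑[ w ∈ words n (suc m) ] ∑[ y ∈ range n ] f (w ∷ʳ y)
      ∎

  ∑-words-lift : ∀ n m {x} (f : List ℕ → ℚ) → 1 ≤ x → x ≤ suc n →
    (∀ w → elemᵇ x w ≡ true → f w ≡ 0ℚ) →
    ∑ (words (suc n) m) f ≡ ∑[ w ∈ words n m ] f (map (lift x) w)
  ∑-words-lift n zero    f _ _ _ = refl
  ∑-words-lift n (suc m) {x} f 1≤x x≤1+n vanish = begin
    ∑ (words (suc n) (suc m)) f
      ≡⟨ ∑-words-∷ (suc n) m f ⟩
    ∑[ y ∈ range (suc n) ] ∑[ w ∈ words (suc n) m ] f (y ∷ w)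
      ≡⟨ ∑-cong (range (suc n)) lift-tail ⟩
    ∑[ y ∈ range (suc n) ] h y
      ≡⟨ ∑-range-lift n h 1≤x x≤1+n hx≡0 ⟩
    ∑[ y ∈ range n ] h (lift x y)
      ≡⟨ ∑-words-∷ n m _ ⟨
    ∑[ w ∈ words n (suc m) ] f (map (lift x) w)
      ∎
    where
    h : ℕ → ℚ
    h y = ∑[ w ∈ words n m ] f (y ∷ map (lift x) w)
    lift-tail : ∀ y → ∑[ w ∈ words (suc n) m ] f (y ∷ w) ≡ h y
    lift-tail y =
      ∑-words-lift n m (f ∘ (y ∷_)) 1≤x x≤1+n (λ w x∈w → vanish (y ∷ w) (elemᵇ-there y w x∈w))
    hx≡0 : h x ≡ 0ℚ
    hx≡0 = trans (∑-cong (words n m) (λ w → vanish (x ∷ map (lift x) w) (elemᵇ-here x (map (lift x) w))))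
                 (∑-zero (words n m))

  words-bounds : ∀ n m → All (λ w → length w ≡ m × All (λ z → 1 ≤ z × z ≤ n) w) (words n m)
  words-bounds n zero    = (refl , []) ∷ []
  words-bounds n (suc m) = concat⁺ (map⁺ (All.map prepend (range-bounds n)))
    where
    prepend : ∀ {x} → 1 ≤ x × x ≤ n →
      All (λ w → length w ≡ suc m × All (λ z → 1 ≤ z × z ≤ n) w) (map (x ∷_) (words n m))
    prepend x-bounds =
      map⁺ (All.map (λ (len , w-bounds) → cong suc len , x-bounds ∷ w-bounds) (words-bounds n m))

  Sym-IsPerm : ∀ n → All (IsPerm n) (Sym n)
  Sym-IsPerm n = All.zipWith toIsPerm (all-filter _ (words n n) , filter⁺ _ (words-bounds n n))
    where
    toIsPerm : ∀ {σ} → distinctᵇ σ ≡ true × (length σ ≡ n × All (λ z → 1 ≤ z × z ≤ n) σ) → IsPerm n σ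
    toIsPerm (dist , len , bounds) = record { length≡ = len ; bounded = bounds ; distinct = dist }

  ∑-Sym-cong : ∀ n {f g : List ℕ → ℚ} → (∀ {σ} → IsPerm n σ → f σ ≡ g σ) → ∑ (Sym n) f ≡ ∑ (Sym n) g
  ∑-Sym-cong n f≗g = ∑-cong-All (All.map f≗g (Sym-IsPerm n))

  does-≟-true : ∀ b → does (b Bool.≟ true) ≡ b
  does-≟-true true  = refl
  does-≟-true false = refl

  does-≟-false : ∀ b → does (b Bool.≟ false) ≡ not b
  does-≟-false true  = refl
  does-≟-false false = refl

  ∑-Sym : ∀ n (f : List ℕ → ℚ) → ∑ (Sym n) f ≡ ∑[ w ∈ words n n ] (⟦ distinctᵇ w ⟧ * f w)
  ∑-Sym n f = trans (∑-filter _ (words n n) f)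
                    (∑-cong (words n n) (λ w → cong (λ b → ⟦ b ⟧ * f w) (does-≟-true (distinctᵇ w))))

  ∑-Sym-extend : ∀ n (f : List ℕ → ℚ) →
    ∑ (Sym (suc n)) f ≡ ∑[ x ∈ range (suc n) ] ∑[ σ ∈ Sym n ] f (extend x σ)
  ∑-Sym-extend n f = begin
    ∑ (Sym (suc n)) f
      ≡⟨ ∑-Sym (suc n) f ⟩
    ∑[ w ∈ words (suc n) (suc n) ] g w
      ≡⟨ ∑-words-∷ʳ (suc n) n g ⟩
    ∑[ w ∈ words (suc n) n ] ∑[ x ∈ range (suc n) ] g (w ∷ʳ x)
      ≡⟨ ∑-comm (words (suc n) n) (range (suc n)) (λ w x → g (w ∷ʳ x)) ⟩
    ∑[ x ∈ range (suc n) ] ∑[ w ∈ words (suc n) n ] g (w ∷ʳ x)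
      ≡⟨ ∑-cong-All (All.map lift-prefix (range-bounds (suc n))) ⟩
    ∑[ x ∈ range (suc n) ] ∑[ σ ∈ words n n ] g (extend x σ)
      ≡⟨ ∑-cong (range (suc n)) (λ x → ∑-cong (words n n) (λ σ →
           cong (λ b → ⟦ b ⟧ * f (extend x σ)) (distinctᵇ-extend x σ))) ⟩
    ∑[ x ∈ range (suc n) ] ∑[ σ ∈ words n n ] (⟦ distinctᵇ σ ⟧ * f (extend x σ))
      ≡⟨ ∑-cong (range (suc n)) (λ x → ∑-Sym n (f ∘ extend x)) ⟨
    ∑[ x ∈ range (suc n) ] ∑[ σ ∈ Sym n ] f (extend x σ)
      ∎
    where
    g : List ℕ → ℚ
    g w = ⟦ distinctᵇ w ⟧ * f w
    repeated : ∀ x w → elemᵇ x w ≡ true → g (w ∷ʳ x) ≡ 0ℚ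
    repeated x w x∈w =
      trans (cong (λ b → ⟦ b ⟧ * f (w ∷ʳ x)) (distinctᵇ-∷ʳ-elem w x x∈w)) (*-zeroˡ (f (w ∷ʳ x)))
    lift-prefix : ∀ {x} → 1 ≤ x × x ≤ suc n →
      ∑[ w ∈ words (suc n) n ] g (w ∷ʳ x) ≡ ∑[ σ ∈ words n n ] g (extend x σ)
    lift-prefix {x} (1≤x , x≤1+n) = ∑-words-lift n n (λ w → g (w ∷ʳ x)) 1≤x x≤1+n (repeated x)

  module _ (θ : ℚ) where

    weight : List ℕ → ℚ
    weight π = pow θ (inv π)

    pow-+ : ∀ a b → pow θ (a ℕ.+ b) ≡ pow θ a * pow θ b
    pow-+ zero    b = sym (*-identityˡ (pow θ b))
    pow-+ (suc a) b = trans (cong (θ *_) (pow-+ a b)) (sym (*-assoc θ (pow θ a) (pow θ b)))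

    ∑-range-pow-∸ : ∀ j n → ∑[ x ∈ range n ] pow θ (j ℕ.+ n ∸ x) ≡ pow θ j * P θ n
    ∑-range-pow-∸ j zero    = sym (*-zeroʳ (pow θ j))
    ∑-range-pow-∸ j (suc n) = begin
      ∑[ x ∈ range (suc n) ] pow θ (j ℕ.+ suc n ∸ x)
        ≡⟨ ∑-range-suc n (λ x → pow θ (j ℕ.+ suc n ∸ x)) ⟩
      ∑[ x ∈ range n ] pow θ (j ℕ.+ suc n ∸ x) + pow θ (j ℕ.+ suc n ∸ suc n)
        ≡⟨ cong₂ _+_ (∑-cong (range n) (λ x → cong (λ i → pow θ (i ∸ x)) (ℕ.+-suc j n)))
                     (cong (λ i → pow θ (i ∸ suc n)) (ℕ.+-suc j n)) ⟩
      ∑[ x ∈ range n ] pow θ (suc j ℕ.+ n ∸ x) + pow θ (j ℕ.+ n ∸ n)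
        ≡⟨ cong₂ _+_ (∑-range-pow-∸ (suc j) n) (cong (pow θ) (ℕ.m+n∸n≡m j n)) ⟩
      θ * pow θ j * P θ n + pow θ j
        ≡⟨ solve 3 (λ t p q → t :* p :* q :+ p := p :* (con 1ℚ :+ t :* q)) refl θ (pow θ j) (P θ n) ⟩
      pow θ j * (1ℚ + θ * P θ n)
        ≡⟨ cong (pow θ j *_) (P-suc θ n) ⟨
      pow θ j * P θ (suc n)
        ∎
      where open +-*-Solver

    weight-extend : ∀ {n σ x} → IsPerm n σ → 1 ≤ x → x ≤ suc n →
      weight (extend x σ) ≡ pow θ (suc n ∸ x) * weight σ
    weight-extend {n} {σ} {x} σ-perm 1≤x x≤1+n =
      trans (cong (pow θ) (inv-extend σ-perm 1≤x x≤1+n))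
            (trans (pow-+ (inv σ) (suc n ∸ x)) (*-comm (weight σ) _))

    ⟦⟧*weight-extend : ∀ b {n σ x} → IsPerm n σ → 1 ≤ x → x ≤ suc n →
      ⟦ b ⟧ * weight (extend x σ) ≡ pow θ (suc n ∸ x) * (⟦ b ⟧ * weight σ)
    ⟦⟧*weight-extend b {n} {σ} {x} σ-perm 1≤x x≤1+n =
      trans (cong (⟦ b ⟧ *_) (weight-extend σ-perm 1≤x x≤1+n))
            (*-leftComm ⟦ b ⟧ (pow θ (suc n ∸ x)) (weight σ))

    ∑-Sym-weight : ∀ n → ∑ (Sym n) weight ≡ Pfact θ n
    ∑-Sym-weight zero    = +-identityʳ 1ℚ
    ∑-Sym-weight (suc n) = begin
      ∑ (Sym (suc n)) weight
        ≡⟨ ∑-Sym-extend n weight ⟩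
      ∑[ x ∈ range (suc n) ] ∑[ σ ∈ Sym n ] weight (extend x σ)
        ≡⟨ ∑-cong-All (All.map factor (range-bounds (suc n))) ⟩
      ∑[ x ∈ range (suc n) ] (pow θ (suc n ∸ x) * Pfact θ n)
        ≡⟨ ∑-*ʳ (range (suc n)) (λ x → pow θ (suc n ∸ x)) (Pfact θ n) ⟩
      (∑[ x ∈ range (suc n) ] pow θ (suc n ∸ x)) * Pfact θ n
        ≡⟨ cong (_* Pfact θ n) (∑-range-pow-∸ 0 (suc n)) ⟩
      1ℚ * P θ (suc n) * Pfact θ n
        ≡⟨ cong (_* Pfact θ n) (*-identityˡ (P θ (suc n))) ⟩
      P θ (suc n) * Pfact θ n
        ∎
      where
      factor : ∀ {x} → 1 ≤ x × x ≤ suc n →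
        ∑[ σ ∈ Sym n ] weight (extend x σ) ≡ pow θ (suc n ∸ x) * Pfact θ n
      factor {x} (1≤x , x≤1+n) = begin
        ∑[ σ ∈ Sym n ] weight (extend x σ)
          ≡⟨ ∑-Sym-cong n (λ σ-perm → weight-extend σ-perm 1≤x x≤1+n) ⟩
        ∑[ σ ∈ Sym n ] (pow θ (suc n ∸ x) * weight σ)
          ≡⟨ ∑-*ˡ (Sym n) (pow θ (suc n ∸ x)) weight ⟩
        pow θ (suc n ∸ x) * ∑ (Sym n) weight
          ≡⟨ cong (pow θ (suc n ∸ x) *_) (∑-Sym-weight n) ⟩
        pow θ (suc n ∸ x) * Pfact θ n
          ∎

    won : ℕ → ℕ → List ℕ → ℚ
    won N k π = ⟦ winnableᵇ N k π ⟧ * weight π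

    unpicked : ℕ → List ℕ → ℚ
    unpicked k π = ⟦ not (pickableᵇ k π) ⟧ * weight π

    W₂-∑ : ∀ N k → W₂ θ N k ≡ ∑ (Sym N) (won N k)
    W₂-∑ N k = trans (∑-filter _ (Sym N) weight)
      (∑-cong (Sym N) (λ π → cong (λ b → ⟦ b ⟧ * weight π) (does-≟-true (winnableᵇ N k π))))

    T₂-∑ : ∀ N k → T₂ θ N k ≡ ∑ (Sym N) (unpicked k)
    T₂-∑ N k = trans (∑-filter _ (Sym N) weight)
      (∑-cong (Sym N) (λ π → cong (λ b → ⟦ b ⟧ * weight π) (does-≟-false (pickableᵇ k π))))

    ∑-won-extend-small : ∀ m {x} k → 1 ≤ x → x ≤ m →
      ∑[ σ ∈ Sym (suc m) ] won (suc (suc m)) k (extend x σ) ≡ pow θ (suc (suc m) ∸ x) * W₂ θ (suc m) k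
    ∑-won-extend-small m {x} k 1≤x x≤m = begin
      ∑[ σ ∈ Sym (suc m) ] won (suc (suc m)) k (extend x σ)
        ≡⟨ ∑-Sym-cong (suc m) scaled ⟩
      ∑[ σ ∈ Sym (suc m) ] (pow θ (suc (suc m) ∸ x) * won (suc m) k σ)
        ≡⟨ ∑-*ˡ (Sym (suc m)) (pow θ (suc (suc m) ∸ x)) (won (suc m) k) ⟩
      pow θ (suc (suc m) ∸ x) * ∑ (Sym (suc m)) (won (suc m) k)
        ≡⟨ cong (pow θ (suc (suc m) ∸ x) *_) (W₂-∑ (suc m) k) ⟨
      pow θ (suc (suc m) ∸ x) * W₂ θ (suc m) k
        ∎
      where
      scaled : ∀ {σ} → IsPerm (suc m) σ →
        won (suc (suc m)) k (extend x σ) ≡ pow θ (suc (suc m) ∸ x) * won (suc m) k σ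
      scaled {σ} σ-perm = trans
        (cong (λ b → ⟦ b ⟧ * weight (extend x σ)) (winnable-extend-small k σ-perm 1≤x x≤m))
        (⟦⟧*weight-extend (winnableᵇ (suc m) k σ) σ-perm 1≤x (ℕ.m≤n⇒m≤1+n (ℕ.m≤n⇒m≤1+n x≤m)))

    ∑-won-extend-secondLargest : ∀ m k → k ≤ m →
      ∑[ σ ∈ Sym (suc m) ] won (suc (suc m)) k (extend (suc m) σ) ≡ θ * T₂ θ (suc m) k
    ∑-won-extend-secondLargest m k k≤m = begin
      ∑[ σ ∈ Sym (suc m) ] won (suc (suc m)) k (extend (suc m) σ)
        ≡⟨ ∑-Sym-cong (suc m) scaled ⟩
      ∑[ σ ∈ Sym (suc m) ] (θ * unpicked k σ)
        ≡⟨ ∑-*ˡ (Sym (suc m)) θ (unpicked k) ⟩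
      θ * ∑ (Sym (suc m)) (unpicked k)
        ≡⟨ cong (θ *_) (T₂-∑ (suc m) k) ⟨
      θ * T₂ θ (suc m) k
        ∎
      where
      pow-1 : pow θ (suc m ∸ m) ≡ θ
      pow-1 = trans (cong (pow θ) (ℕ.m+n∸n≡m 1 m)) (*-identityʳ θ)
      scaled : ∀ {σ} → IsPerm (suc m) σ → won (suc (suc m)) k (extend (suc m) σ) ≡ θ * unpicked k σ
      scaled {σ} σ-perm = trans
        (cong (λ b → ⟦ b ⟧ * weight (extend (suc m) σ)) (winnable-extend-secondLargest k k≤m σ-perm))
        (trans (⟦⟧*weight-extend (not (pickableᵇ k σ)) σ-perm (s≤s z≤n) (ℕ.n≤1+n (suc m)))
               (cong (_* unpicked k σ) pow-1))

    ∑-won-extend-largest : ∀ m k → ∑[ σ ∈ Sym (suc m) ] won (suc (suc m)) k (extend (suc (suc m)) σ) ≡ 0ℚ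
    ∑-won-extend-largest m k = trans (∑-Sym-cong (suc m) lost) (∑-zero (Sym (suc m)))
      where
      lost : ∀ {σ} → IsPerm (suc m) σ → won (suc (suc m)) k (extend (suc (suc m)) σ) ≡ 0ℚ
      lost {σ} σ-perm = trans
        (cong (λ b → ⟦ b ⟧ * weight (extend (suc (suc m)) σ)) (winnable-extend-largest k σ-perm))
        (*-zeroˡ (weight (extend (suc (suc m)) σ)))

    W₂-recurrence : ∀ m k → k ≤ m →
      W₂ θ (suc (suc m)) k ≡ θ * θ * P θ m * W₂ θ (suc m) k + θ * T₂ θ (suc m) k
    W₂-recurrence m k k≤m = begin
      W₂ θ (suc (suc m)) k
        ≡⟨ W₂-∑ (suc (suc m)) k ⟩
      ∑ (Sym (suc (suc m))) (won (suc (suc m)) k)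
        ≡⟨ ∑-Sym-extend (suc m) (won (suc (suc m)) k) ⟩
      ∑[ x ∈ range (suc (suc m)) ] S x
        ≡⟨ ∑-range-suc (suc m) S ⟩
      ∑[ x ∈ range (suc m) ] S x + S (suc (suc m))
        ≡⟨ cong₂ _+_ (∑-range-suc m S) (∑-won-extend-largest m k) ⟩
      ∑[ x ∈ range m ] S x + S (suc m) + 0ℚ
        ≡⟨ +-identityʳ _ ⟩
      ∑[ x ∈ range m ] S x + S (suc m)
        ≡⟨ cong₂ _+_ small (∑-won-extend-secondLargest m k k≤m) ⟩
      θ * θ * P θ m * W₂ θ (suc m) k + θ * T₂ θ (suc m) k
        ∎
      where
      S : ℕ → ℚ
      S x = ∑[ σ ∈ Sym (suc m) ] won (suc (suc m)) k (extend x σ)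
      small : ∑[ x ∈ range m ] S x ≡ θ * θ * P θ m * W₂ θ (suc m) k
      small = begin
        ∑[ x ∈ range m ] S x
          ≡⟨ ∑-cong-All (All.map (λ (1≤x , x≤m) → ∑-won-extend-small m k 1≤x x≤m) (range-bounds m)) ⟩
        ∑[ x ∈ range m ] (pow θ (2 ℕ.+ m ∸ x) * W₂ θ (suc m) k)
          ≡⟨ ∑-*ʳ (range m) (λ x → pow θ (2 ℕ.+ m ∸ x)) (W₂ θ (suc m) k) ⟩
        (∑[ x ∈ range m ] pow θ (2 ℕ.+ m ∸ x)) * W₂ θ (suc m) k
          ≡⟨ cong (_* W₂ θ (suc m) k) (∑-range-pow-∸ 2 m) ⟩
        θ * (θ * 1ℚ) * P θ m * W₂ θ (suc m) k
          ≡⟨ cong (λ t → θ * t * P θ m * W₂ θ (suc m) k) (*-identityʳ θ) ⟩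
        θ * θ * P θ m * W₂ θ (suc m) k
          ∎

    W₂-initial : ∀ k → 1 ≤ k → W₂ θ (suc k) k ≡ θ * Pfact θ k
    W₂-initial k 1≤k = begin
      W₂ θ (suc k) k
        ≡⟨ W₂-∑ (suc k) k ⟩
      ∑ (Sym (suc k)) (won (suc k) k)
        ≡⟨ ∑-Sym-extend k (won (suc k) k) ⟩
      ∑[ x ∈ range (suc k) ] ∑[ σ ∈ Sym k ] won (suc k) k (extend x σ)
        ≡⟨ ∑-cong-All (All.map selected (range-bounds (suc k))) ⟩
      ∑[ x ∈ range (suc k) ] (⟦ k ≡ᵇ x ⟧ * (pow θ (suc k ∸ x) * Pfact θ k))
        ≡⟨ ∑-range-⟦≡ᵇ⟧ (suc k) _ 1≤k (ℕ.n≤1+n k) ⟩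
      pow θ (suc k ∸ k) * Pfact θ k
        ≡⟨ cong (_* Pfact θ k) (trans (cong (pow θ) (ℕ.m+n∸n≡m 1 k)) (*-identityʳ θ)) ⟩
      θ * Pfact θ k
        ∎
      where
      selected : ∀ {x} → 1 ≤ x × x ≤ suc k →
        ∑[ σ ∈ Sym k ] won (suc k) k (extend x σ) ≡ ⟦ k ≡ᵇ x ⟧ * (pow θ (suc k ∸ x) * Pfact θ k)
      selected {x} (1≤x , x≤1+k) = begin
        ∑[ σ ∈ Sym k ] won (suc k) k (extend x σ)
          ≡⟨ ∑-Sym-cong k scaled ⟩
        ∑[ σ ∈ Sym k ] (pow θ (suc k ∸ x) * (⟦ k ≡ᵇ x ⟧ * weight σ))
          ≡⟨ ∑-*ˡ (Sym k) (pow θ (suc k ∸ x)) _ ⟩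
        pow θ (suc k ∸ x) * ∑[ σ ∈ Sym k ] (⟦ k ≡ᵇ x ⟧ * weight σ)
          ≡⟨ cong (pow θ (suc k ∸ x) *_) (∑-*ˡ (Sym k) ⟦ k ≡ᵇ x ⟧ weight) ⟩
        pow θ (suc k ∸ x) * (⟦ k ≡ᵇ x ⟧ * ∑ (Sym k) weight)
          ≡⟨ cong (λ s → pow θ (suc k ∸ x) * (⟦ k ≡ᵇ x ⟧ * s)) (∑-Sym-weight k) ⟩
        pow θ (suc k ∸ x) * (⟦ k ≡ᵇ x ⟧ * Pfact θ k)
          ≡⟨ *-leftComm (pow θ (suc k ∸ x)) ⟦ k ≡ᵇ x ⟧ (Pfact θ k) ⟩
        ⟦ k ≡ᵇ x ⟧ * (pow θ (suc k ∸ x) * Pfact θ k)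
          ∎
        where
        scaled : ∀ {σ} → IsPerm k σ →
          won (suc k) k (extend x σ) ≡ pow θ (suc k ∸ x) * (⟦ k ≡ᵇ x ⟧ * weight σ)
        scaled {σ} σ-perm = trans
          (cong (λ b → ⟦ b ⟧ * weight (extend x σ)) (winnable-extend-initial σ-perm 1≤x x≤1+k))
          (⟦⟧*weight-extend (k ≡ᵇ x) σ-perm 1≤x x≤1+k)

open import Data.Nat using (ℕ; suc; s≤s; _≤_; _+_; _∸_)
open import Data.Nat.Properties using (+-comm)
open import Data.Rational using (ℚ; 0ℚ; _<_; _*_)
open import Data.Product using (_×_; _,_)
open import Relation.Binary.PropositionalEquality using (_≡_; subst)

-- The identities are polynomial in θ.
theorem7 : (θ : ℚ) → 0ℚ < θ → (k : ℕ) → 1 ≤ k →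
    ((N : ℕ) → k + 2 ≤ N →
       W₂ θ N k ≡ Data.Rational._+_ (θ * θ * P θ (N ∸ 2) * W₂ θ (N ∸ 1) k) (θ * T₂ θ (N ∸ 1) k))
    × (W₂ θ (k + 1) k ≡ θ * Pfact θ k)
theorem7 θ _ k 1≤k =
  recurrence , subst (λ N → W₂ θ N k ≡ θ * Pfact θ k) (+-comm 1 k) (W₂-initial θ k 1≤k)
  where
  recurrence : (N : ℕ) → k + 2 ≤ N →
    W₂ θ N k ≡ Data.Rational._+_ (θ * θ * P θ (N ∸ 2) * W₂ θ (N ∸ 1) k) (θ * T₂ θ (N ∸ 1) k)
  recurrence N k+2≤N with N | subst (_≤ N) (+-comm k 2) k+2≤N
  ... | suc (suc m) | s≤s (s≤s k≤m) = W₂-recurrence θ m k k≤m
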